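{- Let $\ell$ be an odd integer and let $G$ be an $\ell$-odd-connected graph. Let $E(A_1,A_2)$ and $E(B_1,B_2)$ be two edge-cuts of $G$, each of size $\ell$, and let $W_{ij}=A_i\cap B_j$ for $i,j\in\{1,2\}$. If all four sets $W_{ij}$ are non-empty, then there exist integers $a,b,c$ with $a+b+c=\ell$ such that one of the following holds: (1) $e(W_{11},W_{12})=e(W_{12},W_{22})=a$, $e(W_{11},W_{21})=e(W_{21},W_{22})=b$, $e(W_{11},W_{22})=c$ and $e(W_{12},W_{21})=0$; or (2) $e(W_{12},W_{11})=e(W_{11},W_{21})=a$, $e(W_{12},W_{22})=e(W_{22},W_{21})=b$, $e(W_{12},W_{21})=c$ and $e(W_{11},W_{22})=0$.
   Context: Graphs may have loops and parallel edges. For a partition $(A,B)$ of the vertex set, the edge-cut $E(A,B)$ is the set of edges with one end in $A$ and the other in $B$; its size is the number of such edges. For vertex sets $X,Y$, $e(X,Y)$ denotes the number of edges with one end in $X$ and the other in $Y$. A graph is $k$-odd-connected if it has no edge-cut of odd size less than $k$. -}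

module Defs where

open import Data.Nat using (ℕ; suc; _+_)
open import Data.Fin using (Fin)
open import Data.Bool using (Bool; true; false; not; _∧_; _∨_; if_then_else_)
open import Data.List using (List; foldr)
open import Data.Product using (_×_; proj₁; proj₂)

open import Data.Product using (∃)
open import Relation.Binary.PropositionalEquality using (_≡_)

Odd : ℕ → Set
Odd m = ∃ λ k → m ≡ suc (k + k)

-- A finite multigraph on vertex set Fin n: a list of edges, each an
-- (unordered) pair of ends. Loops (u , u) and parallel edges allowed.
record Graph : Set where
  field
    n     : ℕ
    edges : List (Fin n × Fin n)
open Graph public

VSet : Graph → Set
VSet G = Fin (n G) → Bool

e : (G : Graph) → VSet G → VSet G → ℕ
e G X Y = foldr (λ uv k → if (X (proj₁ uv) ∧ Y (proj₂ uv)) ∨ (Y (proj₁ uv) ∧ X (proj₂ uv))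
                          then suc k else k) 0 (edges G)

∁ : {G : Graph} → VSet G → VSet G
∁ X v = not (X v)

_∩_ : {G : Graph} → VSet G → VSet G → VSet G
(X ∩ Y) v = X v ∧ Y v

-- A partition (A , V∖A) is given by A; its edge-cut size is e(A, V∖A).
cutSize : (G : Graph) → VSet G → ℕ
cutSize G A = e G A (∁ {G} A)

OddConnected : ℕ → Graph → Set
OddConnected k G = (A : VSet G) → Odd (cutSize G A) → k Data.Nat.≤ cutSize G A

NonEmpty : {G : Graph} → VSet G → Set
NonEmpty {G} X = ∃ λ (v : Fin (n G)) → X v ≡ true

module Submission where

-- Write
--   p = e(W₁₁,W₁₂)  q = e(W₁₂,W₂₂)  r = e(W₁₁,W₂₁)
--   s = e(W₂₁,W₂₂)  c = e(W₁₁,W₂₂)  d = e(W₁₂,W₂₁).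
-- Then |δ(A)| = r+c+d+q, |δ(B)| = p+c+d+s, and the quadrant cuts are
-- δ₁₁ = p+r+c, δ₂₂ = q+s+c, δ₁₂ = p+q+d, δ₂₁ = r+s+d.
-- Since δ₁₁+δ₂₂ = 2ℓ−2d and δ₁₂+δ₂₁ = 2ℓ−2c are even while δ₁₁+δ₁₂ = ℓ+2p
-- is odd, one diagonal pair of quadrants has odd cuts.  By odd-connectivity
-- both are ≥ ℓ, which forces both to be exactly ℓ and the other diagonal
-- to carry no edge; comparing with |δ(A)| = |δ(B)| = ℓ pairs up the rest.

open import Defs
open import Data.Bool using (Bool; true; false; not; _∧_; _∨_; if_then_else_; T)
open import Data.Bool.Properties using (∨-comm; T-∧)
open import Data.Empty using (⊥; ⊥-elim)
open import Data.List using (List; []; _∷_; foldr; map)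
open import Data.Nat.ListAction using (sum)
open import Data.List.Properties using (foldr-cong; map-cong)
open import Data.Nat using (ℕ; zero; suc; _+_; _*_; _≤_; _≡ᵇ_)
open import Data.Nat.Properties
open import Data.Nat.Tactic.RingSolver using (solve)
open import Algebra.Properties.CommutativeSemigroup +-commutativeSemigroup using (interchange)
open import Data.Fin using (Fin)
open import Data.Product using (Σ; ∃; _×_; _,_; proj₁; proj₂; uncurry)
open import Data.Sum using (_⊎_; inj₁; inj₂)
open import Function using (_∘_)
open import Function.Bundles using (Equivalence)
open import Relation.Binary.PropositionalEquality
  using (_≡_; refl; sym; trans; cong; cong₂; subst; module ≡-Reasoning)

sum-map-+ : {X : Set} (f g : X → ℕ) (xs : List X) →
            sum (map (λ x → f x + g x) xs) ≡ sum (map f xs) + sum (map g xs)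
sum-map-+ f g []       = refl
sum-map-+ f g (x ∷ xs) = trans (cong (f x + g x +_) (sum-map-+ f g xs))
                               (interchange (f x) (g x) (sum (map f xs)) (sum (map g xs)))

sum-swap : {X Y : Set} (f : X → Y → ℕ) (xs : List X) (ys : List Y) →
           sum (map (λ x → sum (map (f x) ys)) xs) ≡ sum (map (λ y → sum (map (λ x → f x y) xs)) ys)
sum-swap f []       ys = sym (sum-zeros ys)
  where
  sum-zeros : ∀ {Y : Set} (ys : List Y) → sum (map (λ _ → 0) ys) ≡ 0
  sum-zeros []       = refl
  sum-zeros (_ ∷ ys) = sum-zeros ys
sum-swap f (x ∷ xs) ys = trans (cong (sum (map (f x) ys) +_) (sum-swap f xs ys))
                               (sym (sum-map-+ (f x) (λ y → sum (map (λ x → f x y) xs)) ys))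

sum-of-3 : ∀ x y z → sum (x ∷ y ∷ z ∷ []) ≡ x + y + z
sum-of-3 x y z = trans (cong (λ t → x + (y + t)) (+-identityʳ z)) (sym (+-assoc x y z))

sum-of-4 : ∀ w x y z → sum (w ∷ x ∷ y ∷ z ∷ []) ≡ w + x + y + z
sum-of-4 w x y z = begin
  w + sum (x ∷ y ∷ z ∷ [])  ≡⟨ cong (w +_) (sum-of-3 x y z) ⟩
  w + (x + y + z)           ≡⟨ sym (+-assoc w (x + y) z) ⟩
  w + (x + y) + z           ≡⟨ cong (_+ z) (sym (+-assoc w x y)) ⟩
  w + x + y + z             ∎
  where open ≡-Reasoning

Even : ℕ → Set
Even m = ∃ λ k → m ≡ k + k

parity : ∀ m → Even m ⊎ Odd m
parity zero = inj₁ (0 , refl)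
parity (suc m) with parity m
... | inj₁ (k , refl) = inj₂ (k , refl)
... | inj₂ (k , refl) = inj₁ (suc k , cong suc (sym (+-suc k k)))

¬even×odd : ∀ {m} → Even m → Odd m → ⊥
¬even×odd (i , refl) (j , eq) = even≢odd i j (begin
  2 * i          ≡⟨ solve (i ∷ []) ⟩
  i + i          ≡⟨ eq ⟩
  suc (j + j)    ≡⟨ cong suc (solve (j ∷ [])) ⟩
  suc (2 * j)    ∎)
  where open ≡-Reasoning

even+even : ∀ {m n} → Even m → Even n → Even (m + n)
even+even (i , refl) (j , refl) = i + j , solve (i ∷ j ∷ [])

odd+even : ∀ {m n} → Odd m → Even n → Odd (m + n)
odd+even (i , refl) (j , refl) = i + j , solve (i ∷ j ∷ [])

odd-partner : ∀ {ℓ x y} t → Odd x → x + y + (t + t) ≡ ℓ + ℓ → Odd y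
odd-partner {ℓ} {y = y} t odd-x total with parity y
... | inj₂ odd-y  = odd-y
... | inj₁ even-y = ⊥-elim (¬even×odd (ℓ , refl) (subst Odd total (odd+even (odd+even odd-x even-y) (t , refl))))

even-partner : ∀ {ℓ x y} k → Odd ℓ → Even x → x + y ≡ ℓ + (k + k) → Odd y
even-partner {y = y} k odd-ℓ even-x total with parity y
... | inj₂ odd-y  = odd-y
... | inj₁ even-y = ⊥-elim (¬even×odd (subst Even total (even+even even-x even-y)) (odd+even odd-ℓ (k , refl)))

squeeze : ∀ {ℓ x y} t → ℓ ≤ x → ℓ ≤ y → x + y + (t + t) ≡ ℓ + ℓ → x ≡ ℓ × y ≡ ℓ × t ≡ 0
squeeze {ℓ} {x} {y} t ℓ≤x ℓ≤y total = x≡ℓ , y≡ℓ , t≡0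
  where
  open ≤-Reasoning
  t≡0 : t ≡ 0
  t≡0 = m+n≡0⇒m≡0 t (n≤0⇒n≡0 (+-cancelˡ-≤ (ℓ + ℓ) (t + t) 0 (begin
    ℓ + ℓ + (t + t)  ≤⟨ +-monoˡ-≤ (t + t) (+-mono-≤ ℓ≤x ℓ≤y) ⟩
    x + y + (t + t)  ≡⟨ total ⟩
    ℓ + ℓ            ≡⟨ +-identityʳ (ℓ + ℓ) ⟨
    ℓ + ℓ + 0        ∎)))
  x+y≡2ℓ : x + y ≡ ℓ + ℓ
  x+y≡2ℓ = trans (sym (+-identityʳ (x + y))) (subst (λ t → x + y + (t + t) ≡ ℓ + ℓ) t≡0 total)
  x≡ℓ : x ≡ ℓ
  x≡ℓ = ≤-antisym (+-cancelʳ-≤ ℓ x ℓ (begin x + ℓ ≤⟨ +-monoʳ-≤ x ℓ≤y ⟩ x + y ≡⟨ x+y≡2ℓ ⟩ ℓ + ℓ ∎)) ℓ≤x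
  y≡ℓ : y ≡ ℓ
  y≡ℓ = ≤-antisym (+-cancelˡ-≤ ℓ y ℓ (begin ℓ + y ≤⟨ +-monoˡ-≤ y ℓ≤x ⟩ x + y ≡⟨ x+y≡2ℓ ⟩ ℓ + ℓ ∎)) ℓ≤y

same-complement : ∀ {ℓ} x y m → x + m ≡ ℓ → y + m ≡ ℓ → x ≡ y
same-complement x y m x+m≡ℓ y+m≡ℓ = +-cancelʳ-≡ m x y (trans x+m≡ℓ (sym y+m≡ℓ))

OddBound : ℕ → ℕ → Set
OddBound ℓ x = Odd x → ℓ ≤ x

Configuration : ℕ → (p q r s c d : ℕ) → Set
Configuration ℓ p q r s c d = Σ ℕ λ a → Σ ℕ λ b → Σ ℕ λ c′ → (a + b + c′ ≡ ℓ) ×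
  ((p ≡ a × q ≡ a × r ≡ b × s ≡ b × c ≡ c′ × d ≡ 0)
   ⊎ (p ≡ a × r ≡ a × q ≡ b × s ≡ b × d ≡ c′ × c ≡ 0))

-- Case δ₁₁ odd.  Then δ₂₂ is odd too; both are at least ℓ, so
-- δ₁₁ = δ₂₂ = ℓ and d = 0, and comparing δ₁₁ with |δ(A)| and |δ(B)| gives
-- q = p and s = r: configuration (1).
diagonal-case : ∀ {ℓ} p q r s c d → r + c + d + q ≡ ℓ → p + c + d + s ≡ ℓ →
                OddBound ℓ (p + r + c) → OddBound ℓ (q + s + c) →
                Odd (p + r + c) → Configuration ℓ p q r s c d
diagonal-case {ℓ} p q r s c d cut-A cut-B bound₁₁ bound₂₂ odd₁₁ =
  conclude (squeeze d (bound₁₁ odd₁₁) (bound₂₂ (odd-partner {ℓ} d odd₁₁ total)) total)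
  where
  open ≡-Reasoning
  total : (p + r + c) + (q + s + c) + (d + d) ≡ ℓ + ℓ
  total = begin
    (p + r + c) + (q + s + c) + (d + d)  ≡⟨ solve (p ∷ q ∷ r ∷ s ∷ c ∷ d ∷ []) ⟩
    (r + c + d + q) + (p + c + d + s)    ≡⟨ cong₂ _+_ cut-A cut-B ⟩
    ℓ + ℓ                                ∎
  conclude : p + r + c ≡ ℓ × q + s + c ≡ ℓ × d ≡ 0 → Configuration ℓ p q r s c d
  conclude (δ₁₁≡ℓ , _ , d≡0) = p , r , c , δ₁₁≡ℓ , inj₁ (refl , q≡p , refl , s≡r , refl , d≡0)
    where
    δ₁₁+d≡ℓ : p + r + c + d ≡ ℓ
    δ₁₁+d≡ℓ = trans (cong₂ _+_ δ₁₁≡ℓ d≡0) (+-identityʳ ℓ)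
    q≡p : q ≡ p
    q≡p = same-complement q p (r + c + d)
      (begin q + (r + c + d) ≡⟨ solve (q ∷ r ∷ c ∷ d ∷ []) ⟩ r + c + d + q ≡⟨ cut-A ⟩ ℓ ∎)
      (begin p + (r + c + d) ≡⟨ solve (p ∷ r ∷ c ∷ d ∷ []) ⟩ p + r + c + d ≡⟨ δ₁₁+d≡ℓ ⟩ ℓ ∎)
    s≡r : s ≡ r
    s≡r = same-complement s r (p + c + d)
      (begin s + (p + c + d) ≡⟨ solve (s ∷ p ∷ c ∷ d ∷ []) ⟩ p + c + d + s ≡⟨ cut-B ⟩ ℓ ∎)
      (begin r + (p + c + d) ≡⟨ solve (r ∷ p ∷ c ∷ d ∷ []) ⟩ p + r + c + d ≡⟨ δ₁₁+d≡ℓ ⟩ ℓ ∎)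

-- Case δ₁₁ even.  Then δ₁₂ is odd (δ₁₁ + δ₁₂ = ℓ + 2p), hence so is δ₂₁;
-- both are at least ℓ, so δ₁₂ = δ₂₁ = ℓ and c = 0, and comparing δ₁₂ with
-- |δ(A)| and |δ(B)| gives r = p and s = q: configuration (2).
antidiagonal-case : ∀ {ℓ} p q r s c d → Odd ℓ → r + c + d + q ≡ ℓ → p + c + d + s ≡ ℓ →
                    OddBound ℓ (p + q + d) → OddBound ℓ (r + s + d) →
                    Even (p + r + c) → Configuration ℓ p q r s c d
antidiagonal-case {ℓ} p q r s c d odd-ℓ cut-A cut-B bound₁₂ bound₂₁ even₁₁ =
  conclude (squeeze c (bound₁₂ odd₁₂) (bound₂₁ (odd-partner {ℓ} c odd₁₂ total)) total)
  where
  open ≡-Reasoning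
  odd₁₂ : Odd (p + q + d)
  odd₁₂ = even-partner p odd-ℓ even₁₁ (begin
    (p + r + c) + (p + q + d)  ≡⟨ solve (p ∷ q ∷ r ∷ c ∷ d ∷ []) ⟩
    (r + c + d + q) + (p + p)  ≡⟨ cong (_+ (p + p)) cut-A ⟩
    ℓ + (p + p)                ∎)
  total : (p + q + d) + (r + s + d) + (c + c) ≡ ℓ + ℓ
  total = begin
    (p + q + d) + (r + s + d) + (c + c)  ≡⟨ solve (p ∷ q ∷ r ∷ s ∷ c ∷ d ∷ []) ⟩
    (r + c + d + q) + (p + c + d + s)    ≡⟨ cong₂ _+_ cut-A cut-B ⟩
    ℓ + ℓ                                ∎
  conclude : p + q + d ≡ ℓ × r + s + d ≡ ℓ × c ≡ 0 → Configuration ℓ p q r s c d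
  conclude (δ₁₂≡ℓ , _ , c≡0) = p , q , d , δ₁₂≡ℓ , inj₂ (refl , r≡p , refl , s≡q , refl , c≡0)
    where
    δ₁₂+c≡ℓ : p + q + d + c ≡ ℓ
    δ₁₂+c≡ℓ = trans (cong₂ _+_ δ₁₂≡ℓ c≡0) (+-identityʳ ℓ)
    r≡p : r ≡ p
    r≡p = same-complement r p (q + d + c)
      (begin r + (q + d + c) ≡⟨ solve (r ∷ q ∷ c ∷ d ∷ []) ⟩ r + c + d + q ≡⟨ cut-A ⟩ ℓ ∎)
      (begin p + (q + d + c) ≡⟨ solve (p ∷ q ∷ c ∷ d ∷ []) ⟩ p + q + d + c ≡⟨ δ₁₂+c≡ℓ ⟩ ℓ ∎)
    s≡q : s ≡ q
    s≡q = same-complement s q (p + d + c)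
      (begin s + (p + d + c) ≡⟨ solve (s ∷ p ∷ c ∷ d ∷ []) ⟩ p + c + d + s ≡⟨ cut-B ⟩ ℓ ∎)
      (begin q + (p + d + c) ≡⟨ solve (q ∷ p ∷ c ∷ d ∷ []) ⟩ p + q + d + c ≡⟨ δ₁₂+c≡ℓ ⟩ ℓ ∎)

two-cuts : ∀ {ℓ} p q r s c d → Odd ℓ → r + c + d + q ≡ ℓ → p + c + d + s ≡ ℓ →
           OddBound ℓ (p + r + c) → OddBound ℓ (q + s + c) →
           OddBound ℓ (p + q + d) → OddBound ℓ (r + s + d) →
           Configuration ℓ p q r s c d
two-cuts p q r s c d odd-ℓ cut-A cut-B bound₁₁ bound₂₂ bound₁₂ bound₂₁ with parity (p + r + c)
... | inj₂ odd₁₁  = diagonal-case p q r s c d cut-A cut-B bound₁₁ bound₂₂ odd₁₁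
... | inj₁ even₁₁ = antidiagonal-case p q r s c d odd-ℓ cut-A cut-B bound₁₂ bound₂₁ even₁₁

joins : {V : Set} → (V → Bool) → (V → Bool) → V × V → ℕ
joins X Y (u , v) = if (X u ∧ Y v) ∨ (Y u ∧ X v) then 1 else 0

count-as-sum : {X : Set} (f : X → Bool) (xs : List X) →
               foldr (λ x k → if f x then suc k else k) 0 xs ≡ sum (map (λ x → if f x then 1 else 0) xs)
count-as-sum f []       = refl
count-as-sum f (x ∷ xs) with f x
... | true  = cong suc (count-as-sum f xs)
... | false = count-as-sum f xs

e-as-sum : (G : Graph) (X Y : VSet G) → e G X Y ≡ sum (map (joins X Y) (edges G))
e-as-sum G X Y = count-as-sum (λ uv → (X (proj₁ uv) ∧ Y (proj₂ uv)) ∨ (Y (proj₁ uv) ∧ X (proj₂ uv))) (edges G)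

e-sym : (G : Graph) (X Y : VSet G) → e G X Y ≡ e G Y X
e-sym G X Y = foldr-cong (λ uv k → cong (λ b → if b then suc k else k)
                                        (∨-comm (X (proj₁ uv) ∧ Y (proj₂ uv)) (Y (proj₁ uv) ∧ X (proj₂ uv))))
                         refl (edges G)

every : (Bool → Bool) → Bool
every P = P true ∧ P false

every-sound : (P : Bool → Bool) → T (every P) → ∀ b → T (P b)
every-sound P ok true  = proj₁ (Equivalence.to T-∧ ok)
every-sound P ok false = proj₂ (Equivalence.to T-∧ ok)

-- Two vertex sets A and B place every vertex in one of four quadrants,
-- recorded as (v ∈ A , v ∈ B).  A region is a union of quadrants.
Quadrant : Set
Quadrant = Bool × Bool

Region : Set
Region = Quadrant → Bool

W₁₁ W₁₂ W₂₁ W₂₂ inA inB : Region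
W₁₁ (a , b) = a ∧ b
W₁₂ (a , b) = a ∧ not b
W₂₁ (a , b) = not a ∧ b
W₂₂ (a , b) = not a ∧ not b
inA (a , _) = a
inB (_ , b) = b

weight : List (Region × Region) → Quadrant × Quadrant → ℕ
weight FHs xy = sum (map (λ FH → joins (proj₁ FH) (proj₂ FH) xy) FHs)

Agrees : Region → Region → List (Region × Region) → Bool → Bool → Bool → Bool → Bool
Agrees F H FHs a b a′ b′ = joins F H ((a , b) , (a′ , b′)) ≡ᵇ weight FHs ((a , b) , (a′ , b′))

Balanced : Region → Region → List (Region × Region) → Bool
Balanced F H FHs = every λ a → every λ b → every λ a′ → every λ b′ → Agrees F H FHs a b a′ b′

balanced-sound : (F H : Region) (FHs : List (Region × Region)) → T (Balanced F H FHs) →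
                 ∀ xy → joins F H xy ≡ weight FHs xy
balanced-sound F H FHs ok ((a , b) , (a′ , b′)) = ≡ᵇ⇒≡ _ _ (every-sound (Agrees F H FHs a b a′) ok-a′ b′)
  where
  ok-a : T (every λ b → every λ a′ → every (Agrees F H FHs a b a′))
  ok-a = every-sound (λ a → every λ b → every λ a′ → every (Agrees F H FHs a b a′)) ok a
  ok-b : T (every λ a′ → every (Agrees F H FHs a b a′))
  ok-b = every-sound (λ b → every λ a′ → every (Agrees F H FHs a b a′)) ok-a b
  ok-a′ : T (every (Agrees F H FHs a b a′))
  ok-a′ = every-sound (λ a′ → every (Agrees F H FHs a b a′)) ok-b a′

module Quadrants (G : Graph) (A B : VSet G) where

  quadrant : Fin (n G) → Quadrant
  quadrant v = A v , B v

  ⟦_⟧ : Region → VSet G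
  ⟦ F ⟧ = F ∘ quadrant

  E : Region → Region → ℕ
  E F H = e G ⟦ F ⟧ ⟦ H ⟧

  -- An identity between edge counts of regions that holds edge by edge
  -- (i.e. for each pair of quadrants) holds in G.
  by-quadrants : (F H : Region) (FHs : List (Region × Region)) → T (Balanced F H FHs) →
                 E F H ≡ sum (map (uncurry E) FHs)
  by-quadrants F H FHs ok = begin
    E F H
      ≡⟨ e-as-sum G ⟦ F ⟧ ⟦ H ⟧ ⟩
    sum (map (joins ⟦ F ⟧ ⟦ H ⟧) (edges G))
      ≡⟨ cong sum (map-cong (λ uv → balanced-sound F H FHs ok (ends uv)) (edges G)) ⟩
    sum (map (λ uv → weight FHs (ends uv)) (edges G))
      ≡⟨ sym (sum-swap (λ FH uv → joins ⟦ proj₁ FH ⟧ ⟦ proj₂ FH ⟧ uv) FHs (edges G)) ⟩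
    sum (map (λ FH → sum (map (joins ⟦ proj₁ FH ⟧ ⟦ proj₂ FH ⟧) (edges G))) FHs)
      ≡⟨ cong sum (map-cong (λ FH → sym (e-as-sum G ⟦ proj₁ FH ⟧ ⟦ proj₂ FH ⟧)) FHs) ⟩
    sum (map (uncurry E) FHs) ∎
    where
    open ≡-Reasoning
    ends : Fin (n G) × Fin (n G) → Quadrant × Quadrant
    ends (u , v) = quadrant u , quadrant v

  p q r s c d : ℕ
  p = E W₁₁ W₁₂
  q = E W₁₂ W₂₂
  r = E W₁₁ W₂₁
  s = E W₂₁ W₂₂
  c = E W₁₁ W₂₂
  d = E W₁₂ W₂₁

  cut-A : cutSize G A ≡ r + c + d + q
  cut-A = trans (by-quadrants inA (not ∘ inA) ((W₁₁ , W₂₁) ∷ (W₁₁ , W₂₂) ∷ (W₁₂ , W₂₁) ∷ (W₁₂ , W₂₂) ∷ []) _)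
                (sum-of-4 r c d q)

  cut-B : cutSize G B ≡ p + c + d + s
  cut-B = trans (by-quadrants inB (not ∘ inB) ((W₁₁ , W₁₂) ∷ (W₁₁ , W₂₂) ∷ (W₁₂ , W₂₁) ∷ (W₂₁ , W₂₂) ∷ []) _)
                (sum-of-4 p c d s)

  cut-W₁₁ : cutSize G ⟦ W₁₁ ⟧ ≡ p + r + c
  cut-W₁₁ = trans (by-quadrants W₁₁ (not ∘ W₁₁) ((W₁₁ , W₁₂) ∷ (W₁₁ , W₂₁) ∷ (W₁₁ , W₂₂) ∷ []) _)
                  (sum-of-3 p r c)

  cut-W₂₂ : cutSize G ⟦ W₂₂ ⟧ ≡ q + s + c
  cut-W₂₂ = trans (by-quadrants W₂₂ (not ∘ W₂₂) ((W₁₂ , W₂₂) ∷ (W₂₁ , W₂₂) ∷ (W₁₁ , W₂₂) ∷ []) _)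
                  (sum-of-3 q s c)

  cut-W₁₂ : cutSize G ⟦ W₁₂ ⟧ ≡ p + q + d
  cut-W₁₂ = trans (by-quadrants W₁₂ (not ∘ W₁₂) ((W₁₁ , W₁₂) ∷ (W₁₂ , W₂₂) ∷ (W₁₂ , W₂₁) ∷ []) _)
                  (sum-of-3 p q d)

  cut-W₂₁ : cutSize G ⟦ W₂₁ ⟧ ≡ r + s + d
  cut-W₂₁ = trans (by-quadrants W₂₁ (not ∘ W₂₁) ((W₁₁ , W₂₁) ∷ (W₂₁ , W₂₂) ∷ (W₁₂ , W₂₁) ∷ []) _)
                  (sum-of-3 r s d)

  -- A configuration of the six counts is exactly the conclusion of the
  -- theorem, once e(W₁₂,W₁₁) and e(W₂₂,W₂₁) are read symmetrically.
  from-configuration : ∀ {ℓ} → Configuration ℓ p q r s c d →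
    Σ ℕ λ a → Σ ℕ λ b → Σ ℕ λ c′ → (a + b + c′ ≡ ℓ) ×
      ((E W₁₁ W₁₂ ≡ a × E W₁₂ W₂₂ ≡ a × E W₁₁ W₂₁ ≡ b × E W₂₁ W₂₂ ≡ b × E W₁₁ W₂₂ ≡ c′ × E W₁₂ W₂₁ ≡ 0)
       ⊎ (E W₁₂ W₁₁ ≡ a × E W₁₁ W₂₁ ≡ a × E W₁₂ W₂₂ ≡ b × E W₂₂ W₂₁ ≡ b × E W₁₂ W₂₁ ≡ c′ × E W₁₁ W₂₂ ≡ 0))
  from-configuration (a , b , c′ , sum≡ℓ , inj₁ counts) = a , b , c′ , sum≡ℓ , inj₁ counts
  from-configuration (a , b , c′ , sum≡ℓ , inj₂ (p≡a , r≡a , q≡b , s≡b , d≡c′ , c≡0)) =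
    a , b , c′ , sum≡ℓ ,
    inj₂ (trans (e-sym G ⟦ W₁₂ ⟧ ⟦ W₁₁ ⟧) p≡a , r≡a , q≡b , trans (e-sym G ⟦ W₂₂ ⟧ ⟦ W₂₁ ⟧) s≡b , d≡c′ , c≡0)

lemma3 : (ℓ : ℕ) → Odd ℓ → (G : Graph) → OddConnected ℓ G →
    (A B : VSet G) →
    cutSize G A ≡ ℓ → cutSize G B ≡ ℓ →
    let W11 = _∩_ {G} A B
        W12 = _∩_ {G} A (∁ {G} B)
        W21 = _∩_ {G} (∁ {G} A) B
        W22 = _∩_ {G} (∁ {G} A) (∁ {G} B)
    in NonEmpty {G} W11 → NonEmpty {G} W12 → NonEmpty {G} W21 → NonEmpty {G} W22 →
    Σ ℕ λ a → Σ ℕ λ b → Σ ℕ λ c → (a + b + c ≡ ℓ) ×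
      ((e G W11 W12 ≡ a × e G W12 W22 ≡ a × e G W11 W21 ≡ b × e G W21 W22 ≡ b
          × e G W11 W22 ≡ c × e G W12 W21 ≡ 0)
       ⊎ (e G W12 W11 ≡ a × e G W11 W21 ≡ a × e G W12 W22 ≡ b × e G W22 W21 ≡ b
          × e G W12 W21 ≡ c × e G W11 W22 ≡ 0))
lemma3 ℓ odd-ℓ G odd-connected A B |δA|≡ℓ |δB|≡ℓ _ _ _ _ =
  from-configuration
    (two-cuts p q r s c d odd-ℓ (trans (sym cut-A) |δA|≡ℓ) (trans (sym cut-B) |δB|≡ℓ)
              (odd-bound ⟦ W₁₁ ⟧ cut-W₁₁) (odd-bound ⟦ W₂₂ ⟧ cut-W₂₂)
              (odd-bound ⟦ W₁₂ ⟧ cut-W₁₂) (odd-bound ⟦ W₂₁ ⟧ cut-W₂₁))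
  where
  open Quadrants G A B
  odd-bound : ∀ X {k} → cutSize G X ≡ k → OddBound ℓ k
  odd-bound X |δX|≡k odd-k = subst (ℓ ≤_) |δX|≡k (odd-connected X (subst Odd (sym |δX|≡k) odd-k))
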